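{- Let $n_1,n_2,n_3\ge 2$ and let $k\ge 2$ be even. If $P_{n_1}\Box P_{n_2}\Box P_{n_3}$ has a $(k+1)$-resolving set, then $\dim_{k+1}(P_{n_1}\Box P_{n_2}\Box P_{n_3})\ge 2k+3$.
   Context: $P_{n_1}\Box P_{n_2}\Box P_{n_3}$ is the grid graph with vertex set $\{(x_1,x_2,x_3): 0\le x_i\le n_i-1\}$, two vertices adjacent iff they differ by exactly $1$ in exactly one coordinate; $d(x,y)=\sum_i|x_i-y_i|$. A set $S$ of vertices is a $k$-resolving set if every pair of distinct vertices $x,y$ satisfies $d(w,x)\ne d(w,y)$ for at least $k$ vertices $w\in S$. When one exists, $\dim_k$ is the minimum cardinality of a $k$-resolving set. -}

module Defs where

open import Data.Nat using (ℕ; _+_; _≤_; ∣_-_∣; _≟_)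
open import Data.Fin using (Fin; toℕ)
open import Data.Product using (_×_; _,_)
open import Data.List using (List; length; filter)
open import Data.List.Relation.Unary.Unique.Propositional using (Unique)
open import Relation.Binary.PropositionalEquality using (_≡_)
open import Relation.Nullary using (¬_; ¬?)

Vertex : ℕ → ℕ → ℕ → Set
Vertex n₁ n₂ n₃ = Fin n₁ × Fin n₂ × Fin n₃

dist : ∀ {n₁ n₂ n₃} → Vertex n₁ n₂ n₃ → Vertex n₁ n₂ n₃ → ℕ
dist (x₁ , x₂ , x₃) (y₁ , y₂ , y₃) =
  ∣ toℕ x₁ - toℕ y₁ ∣ + ∣ toℕ x₂ - toℕ y₂ ∣ + ∣ toℕ x₃ - toℕ y₃ ∣

resolvers : ∀ {n₁ n₂ n₃} → List (Vertex n₁ n₂ n₃) →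
            Vertex n₁ n₂ n₃ → Vertex n₁ n₂ n₃ → ℕ
resolvers S x y = length (filter (λ w → ¬? (dist w x ≟ dist w y)) S)

IsKResolving : ∀ {n₁ n₂ n₃} → ℕ → List (Vertex n₁ n₂ n₃) → Set
IsKResolving k S = Unique S × (∀ x y → ¬ (x ≡ y) → k ≤ resolvers S x y)

-- Look at the seven vertices o, e₁, e₂, e₃, e₁+e₂, e₁+e₃, e₂+e₃ of the unit cube at the
-- corner of the grid. A vertex w with support pattern σ ∈ {0,1}³ has
-- d(w, u) = |w| + |u| − 2⟨σ, u⟩ for every such corner u, so w resolves eᵢ, eⱼ iff σᵢ ≠ σⱼ,
-- and resolves o, eᵢ+eⱼ iff σᵢ + σⱼ ≠ 1, i.e. iff σᵢ = σⱼ. Hence every w of S resolves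
-- exactly one pair of {eᵢ, eⱼ}, {o, eᵢ+eⱼ}, and an even number of the pairs {eᵢ, eⱼ}.
-- Counting over S: the numbers rᵢⱼ of vertices of S resolving eᵢ, eⱼ satisfy
-- k+1 ≤ rᵢⱼ ≤ |S| − (k+1) and r₁₂ + r₁₃ + r₂₃ is even. If |S| ≤ 2k+2 all three equal k+1,
-- whose triple is odd for even k.
module Submission where

open import Defs
open import Data.Nat using (ℕ; _+_; _*_; _≤_; _%_)
open import Data.List using (List; length)
open import Data.Product using (Σ)
open import Relation.Binary.PropositionalEquality using (_≡_)

open import Data.Nat using (zero; suc; _<_; _≟_; ∣_-_∣; _≤?_; z≤n; s≤s)
open import Data.Nat.Properties
open import Data.Nat.Divisibility using (_∣_; _∣?_; _∣0; ∣-refl; ∣m∣n⇒∣m+n; ∣m+n∣m⇒∣n; ∣n⇒∣m*n; m%n≡0⇒n∣m)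
open import Data.Nat.Tactic.RingSolver using (solve-∀)
open import Data.Fin using (Fin; toℕ; zero; suc; _↑ˡ_)
open import Data.List using ([]; _∷_)
open import Data.List.Properties using (filter-accept; filter-reject)
open import Data.Product using (_,_)
open import Relation.Nullary using (¬_; ¬?; yes; no; contradiction)
open import Relation.Nullary.Decidable using (from-no)
open import Relation.Binary.PropositionalEquality using (refl; sym; trans; cong; cong₂; subst; module ≡-Reasoning)

differ : ℕ → ℕ → ℕ
differ m n with m ≟ n
... | yes _ = 0
... | no _  = 1

differ-cancel : ∀ {m n p q} → m + p ≡ n + q → differ m n ≡ differ p q
differ-cancel {m} {n} {p} {q} eq with m ≟ n | p ≟ q
... | yes _    | yes _   = refl
... | no _     | no _    = refl
... | yes refl | no p≢q  = contradiction (+-cancelˡ-≡ m p q eq) p≢q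
... | no m≢n   | yes refl = contradiction (+-cancelʳ-≡ p m n eq) m≢n

module _ {n₁ n₂ n₃ : ℕ} where

  separates : (w x y : Vertex n₁ n₂ n₃) → ℕ
  separates w x y = differ (dist w x) (dist w y)

  resolvers-∷ : ∀ w S (x y : Vertex n₁ n₂ n₃) →
                resolvers (w ∷ S) x y ≡ separates w x y + resolvers S x y
  resolvers-∷ w S x y with dist w x ≟ dist w y
  ... | yes eq = cong length (filter-reject (λ v → ¬? (dist v x ≟ dist v y)) {w} {S} (λ neq → neq eq))
  ... | no neq = cong length (filter-accept (λ v → ¬? (dist v x ≟ dist v y)) {w} {S} neq)

  resolvers-complementary :
    ∀ {x y x′ y′} → (∀ w → separates w x y + separates w x′ y′ ≡ 1) →
    ∀ S → resolvers S x y + resolvers S x′ y′ ≡ length S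
  resolvers-complementary h [] = refl
  resolvers-complementary {x} {y} {x′} {y′} h (w ∷ S) = begin
    resolvers (w ∷ S) x y + resolvers (w ∷ S) x′ y′
      ≡⟨ cong₂ _+_ (resolvers-∷ w S x y) (resolvers-∷ w S x′ y′) ⟩
    (separates w x y + resolvers S x y) + (separates w x′ y′ + resolvers S x′ y′)
      ≡⟨ interchange (separates w x y) (resolvers S x y) (separates w x′ y′) _ ⟩
    (separates w x y + separates w x′ y′) + (resolvers S x y + resolvers S x′ y′)
      ≡⟨ cong₂ _+_ (h w) (resolvers-complementary h S) ⟩
    suc (length S) ∎
    where
    open ≡-Reasoning
    interchange : ∀ a r b q → (a + r) + (b + q) ≡ (a + b) + (r + q)
    interchange = solve-∀

  resolvers-even :
    ∀ {x y x′ y′ x″ y″} →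
    (∀ w → 2 ∣ separates w x y + separates w x′ y′ + separates w x″ y″) →
    ∀ S → 2 ∣ resolvers S x y + resolvers S x′ y′ + resolvers S x″ y″
  resolvers-even h [] = 2 ∣0
  resolvers-even {x} {y} {x′} {y′} {x″} {y″} h (w ∷ S)
    rewrite resolvers-∷ w S x y | resolvers-∷ w S x′ y′ | resolvers-∷ w S x″ y″ =
    subst (2 ∣_)
      (interchange₃ (separates w x y) (resolvers S x y) (separates w x′ y′)
                    (resolvers S x′ y′) (separates w x″ y″) (resolvers S x″ y″))
      (∣m∣n⇒∣m+n (h w) (resolvers-even h S))
    where
    interchange₃ : ∀ a r b q c t → (a + b + c) + (r + q + t) ≡ (a + r) + (b + q) + (c + t)
    interchange₃ = solve-∀

norm : ∀ {n₁ n₂ n₃} → Vertex n₁ n₂ n₃ → ℕ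
norm (x₁ , x₂ , x₃) = toℕ x₁ + toℕ x₂ + toℕ x₃

nonzero : ∀ {n} → Fin n → Fin 2
nonzero zero    = zero
nonzero (suc _) = suc zero

inner : Vertex 2 2 2 → Vertex 2 2 2 → ℕ
inner (u₁ , u₂ , u₃) (s₁ , s₂ , s₃) = toℕ u₁ * toℕ s₁ + toℕ u₂ * toℕ s₂ + toℕ u₃ * toℕ s₃

dist-to-bit : ∀ {n} (x : Fin (2 + n)) (i : Fin 2) →
              ∣ toℕ x - toℕ (i ↑ˡ n) ∣ + 2 * (toℕ i * toℕ (nonzero x)) ≡ toℕ x + toℕ i
dist-to-bit zero    zero       = refl
dist-to-bit zero    (suc zero) = refl
dist-to-bit (suc x) zero       = refl
dist-to-bit (suc x) (suc zero) = begin
  ∣ toℕ x - 0 ∣ + 2 ≡⟨ cong (_+ 2) (∣-∣-identityʳ (toℕ x)) ⟩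
  toℕ x + 2         ≡⟨ +-suc (toℕ x) 1 ⟩
  suc (toℕ x + 1)   ∎
  where open ≡-Reasoning

module _ {a b c : ℕ} where

  corner : Vertex 2 2 2 → Vertex (2 + a) (2 + b) (2 + c)
  corner (i₁ , i₂ , i₃) = i₁ ↑ˡ a , i₂ ↑ˡ b , i₃ ↑ˡ c

  support : Vertex (2 + a) (2 + b) (2 + c) → Vertex 2 2 2
  support (x₁ , x₂ , x₃) = nonzero x₁ , nonzero x₂ , nonzero x₃

  dist-corner : ∀ w u → dist w (corner u) + 2 * inner u (support w) ≡ norm w + norm u
  dist-corner (x₁ , x₂ , x₃) (i₁ , i₂ , i₃) = begin
    (d₁ + d₂ + d₃) + 2 * (m₁ + m₂ + m₃)         ≡⟨ regroup d₁ d₂ d₃ m₁ m₂ m₃ ⟩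
    (d₁ + 2 * m₁) + (d₂ + 2 * m₂) + (d₃ + 2 * m₃)
      ≡⟨ cong₂ _+_ (cong₂ _+_ (dist-to-bit x₁ i₁) (dist-to-bit x₂ i₂)) (dist-to-bit x₃ i₃) ⟩
    (t₁ + j₁) + (t₂ + j₂) + (t₃ + j₃)           ≡⟨ regroup′ t₁ t₂ t₃ j₁ j₂ j₃ ⟩
    (t₁ + t₂ + t₃) + (j₁ + j₂ + j₃)             ∎
    where
    open ≡-Reasoning
    t₁ = toℕ x₁; t₂ = toℕ x₂; t₃ = toℕ x₃
    j₁ = toℕ i₁; j₂ = toℕ i₂; j₃ = toℕ i₃
    d₁ = ∣ t₁ - toℕ (i₁ ↑ˡ a) ∣; d₂ = ∣ t₂ - toℕ (i₂ ↑ˡ b) ∣; d₃ = ∣ t₃ - toℕ (i₃ ↑ˡ c) ∣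
    m₁ = j₁ * toℕ (nonzero x₁); m₂ = j₂ * toℕ (nonzero x₂); m₃ = j₃ * toℕ (nonzero x₃)
    regroup : ∀ d₁ d₂ d₃ m₁ m₂ m₃ →
      (d₁ + d₂ + d₃) + 2 * (m₁ + m₂ + m₃) ≡ (d₁ + 2 * m₁) + (d₂ + 2 * m₂) + (d₃ + 2 * m₃)
    regroup = solve-∀
    regroup′ : ∀ t₁ t₂ t₃ j₁ j₂ j₃ →
      (t₁ + j₁) + (t₂ + j₂) + (t₃ + j₃) ≡ (t₁ + t₂ + t₃) + (j₁ + j₂ + j₃)
    regroup′ = solve-∀

-- By dist-corner, whether a vertex with support pattern s resolves the corners u and v.
cornerSeparates : (s u v : Vertex 2 2 2) → ℕ
cornerSeparates s u v = differ (2 * inner u s + norm v) (2 * inner v s + norm u)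

module _ {a b c : ℕ} where

  separates-corner : ∀ (w : Vertex (2 + a) (2 + b) (2 + c)) u v →
                     separates w (corner u) (corner v) ≡ cornerSeparates (support w) u v
  separates-corner w u v = differ-cancel (begin
    dᵤ + (2 * inner u s + norm v) ≡⟨ sym (+-assoc dᵤ _ (norm v)) ⟩
    dᵤ + 2 * inner u s + norm v   ≡⟨ cong (_+ norm v) (dist-corner w u) ⟩
    norm w + norm u + norm v      ≡⟨ +-assoc (norm w) (norm u) (norm v) ⟩
    norm w + (norm u + norm v)    ≡⟨ cong (norm w +_) (+-comm (norm u) (norm v)) ⟩
    norm w + (norm v + norm u)    ≡⟨ +-assoc (norm w) (norm v) (norm u) ⟨
    norm w + norm v + norm u      ≡⟨ cong (_+ norm u) (dist-corner w v) ⟨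
    dᵥ + 2 * inner v s + norm u   ≡⟨ +-assoc dᵥ _ (norm u) ⟩
    dᵥ + (2 * inner v s + norm u) ∎)
    where
    open ≡-Reasoning
    s = support w
    dᵤ = dist w (corner u)
    dᵥ = dist w (corner v)

  corner-resolvers-complementary :
    ∀ {u v u′ v′} → (∀ s → cornerSeparates s u v + cornerSeparates s u′ v′ ≡ 1) →
    ∀ S → resolvers S (corner u) (corner v) + resolvers S (corner u′) (corner v′) ≡ length S
  corner-resolvers-complementary {u} {v} {u′} {v′} h = resolvers-complementary λ w →
    trans (cong₂ _+_ (separates-corner w u v) (separates-corner w u′ v′)) (h (support w))

  corner-resolvers-even :
    ∀ {u v u′ v′ u″ v″} →
    (∀ s → 2 ∣ cornerSeparates s u v + cornerSeparates s u′ v′ + cornerSeparates s u″ v″) →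
    ∀ S → 2 ∣ resolvers S (corner u) (corner v) + resolvers S (corner u′) (corner v′)
                + resolvers S (corner u″) (corner v″)
  corner-resolvers-even {u} {v} {u′} {v′} {u″} {v″} h = resolvers-even λ w →
    subst (2 ∣_)
      (sym (cong₂ _+_ (cong₂ _+_ (separates-corner w u v) (separates-corner w u′ v′))
                      (separates-corner w u″ v″)))
      (h (support w))

o e₁ e₂ e₃ e₁₂ e₁₃ e₂₃ : Vertex 2 2 2
o   = zero     , zero     , zero
e₁  = suc zero , zero     , zero
e₂  = zero     , suc zero , zero
e₃  = zero     , zero     , suc zero
e₁₂ = suc zero , suc zero , zero
e₁₃ = suc zero , zero     , suc zero
e₂₃ = zero     , suc zero , suc zero

units-or-diagonal₁₂ : ∀ s → cornerSeparates s e₁ e₂ + cornerSeparates s o e₁₂ ≡ 1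
units-or-diagonal₁₂ (zero     , zero     , _) = refl
units-or-diagonal₁₂ (zero     , suc zero , _) = refl
units-or-diagonal₁₂ (suc zero , zero     , _) = refl
units-or-diagonal₁₂ (suc zero , suc zero , _) = refl

units-or-diagonal₁₃ : ∀ s → cornerSeparates s e₁ e₃ + cornerSeparates s o e₁₃ ≡ 1
units-or-diagonal₁₃ (zero     , _ , zero    ) = refl
units-or-diagonal₁₃ (zero     , _ , suc zero) = refl
units-or-diagonal₁₃ (suc zero , _ , zero    ) = refl
units-or-diagonal₁₃ (suc zero , _ , suc zero) = refl

units-or-diagonal₂₃ : ∀ s → cornerSeparates s e₂ e₃ + cornerSeparates s o e₂₃ ≡ 1
units-or-diagonal₂₃ (_ , zero     , zero    ) = refl
units-or-diagonal₂₃ (_ , zero     , suc zero) = refl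
units-or-diagonal₂₃ (_ , suc zero , zero    ) = refl
units-or-diagonal₂₃ (_ , suc zero , suc zero) = refl

units-separated-evenly : ∀ s → 2 ∣ cornerSeparates s e₁ e₂ + cornerSeparates s e₁ e₃
                                   + cornerSeparates s e₂ e₃
units-separated-evenly (zero     , zero     , zero    ) = 2 ∣0
units-separated-evenly (zero     , zero     , suc zero) = ∣-refl
units-separated-evenly (zero     , suc zero , zero    ) = ∣-refl
units-separated-evenly (zero     , suc zero , suc zero) = ∣-refl
units-separated-evenly (suc zero , zero     , zero    ) = ∣-refl
units-separated-evenly (suc zero , zero     , suc zero) = ∣-refl
units-separated-evenly (suc zero , suc zero , zero    ) = ∣-refl
units-separated-evenly (suc zero , suc zero , suc zero) = 2 ∣0

pinned : ∀ {m r q} → r + q ≤ m + m → m ≤ r → m ≤ q → r ≡ m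
pinned {m} {r} r+q≤m+m m≤r m≤q =
  ≤-antisym (+-cancelʳ-≤ m r m (≤-trans (+-monoʳ-≤ r m≤q) r+q≤m+m)) m≤r

odd-triple : ∀ {k} → 2 ∣ k → ¬ 2 ∣ (k + 1) + (k + 1) + (k + 1)
odd-triple {k} 2∣k 2∣triple =
  from-no (2 ∣? 3) (∣m+n∣m⇒∣n (subst (2 ∣_) (triple≡ k) 2∣triple) (∣n⇒∣m*n 3 2∣k))
  where
  triple≡ : ∀ k → (k + 1) + (k + 1) + (k + 1) ≡ 3 * k + 3
  triple≡ = solve-∀

below-2k+3 : ∀ {k L} → ¬ 2 * k + 3 ≤ L → L ≤ (k + 1) + (k + 1)
below-2k+3 {k} {L} 2k+3≰L = ≤-pred (subst (L <_) (2k+3≡ k) (≰⇒> 2k+3≰L))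
  where
  2k+3≡ : ∀ k → 2 * k + 3 ≡ suc ((k + 1) + (k + 1))
  2k+3≡ = solve-∀

proposition15 : (n₁ n₂ n₃ k : ℕ) → 2 ≤ n₁ → 2 ≤ n₂ → 2 ≤ n₃ →
    2 ≤ k → k % 2 ≡ 0 →
    Σ (List (Vertex n₁ n₂ n₃)) (IsKResolving (k + 1)) →
    (S : List (Vertex n₁ n₂ n₃)) → IsKResolving (k + 1) S →
    2 * k + 3 ≤ length S
proposition15 (suc (suc a)) (suc (suc b)) (suc (suc c)) k (s≤s (s≤s z≤n)) (s≤s (s≤s z≤n))
  (s≤s (s≤s z≤n)) _ k%2≡0 _ S (_ , resolving) with 2 * k + 3 ≤? length S
... | yes large = large
... | no small  = contradiction
  (subst (2 ∣_) all-pinned (corner-resolvers-even units-separated-evenly S))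
  (odd-triple (m%n≡0⇒n∣m k 2 k%2≡0))
  where
  exactly : ∀ {u v u′ v′} →
    (∀ s → cornerSeparates s u v + cornerSeparates s u′ v′ ≡ 1) →
    ¬ corner u ≡ corner v → ¬ corner u′ ≡ corner v′ →
    resolvers S (corner {a} {b} {c} u) (corner v) ≡ k + 1
  exactly h u≢v u′≢v′ =
    pinned (subst (_≤ (k + 1) + (k + 1)) (sym (corner-resolvers-complementary h S))
                   (below-2k+3 {k} small))
           (resolving _ _ u≢v) (resolving _ _ u′≢v′)
  all-pinned : resolvers S (corner e₁) (corner e₂) + resolvers S (corner e₁) (corner e₃)
               + resolvers S (corner e₂) (corner e₃) ≡ (k + 1) + (k + 1) + (k + 1)
  all-pinned = cong₂ _+_
    (cong₂ _+_ (exactly {e₁} {e₂} {o} {e₁₂} units-or-diagonal₁₂ (λ ()) (λ ()))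
               (exactly {e₁} {e₃} {o} {e₁₃} units-or-diagonal₁₃ (λ ()) (λ ())))
    (exactly {e₂} {e₃} {o} {e₂₃} units-or-diagonal₂₃ (λ ()) (λ ()))
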